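{- Let $G$ be an $r$-cop-win graph ($r\in\{0,1\}$) of finite corner rank $\alpha\ge2$. (1) If for some $t\ge1$, after $t$ cop moves the cop has $k$-cornered the robber for some $k\le\alpha-r-t$ (condition LW at time $t$), then the cop can play so that condition LW holds at every later time $t'\ge t$ for the rest of the game, i.e., after $t'$ cop moves she $k$-corners the robber for some $k\le\alpha-r-t'$. (2) If for some $t\ge1$, after $t$ cop moves the cop has $k$-caught the robber for some $k\le\alpha-r-t+1$ (condition C at time $t$), then the cop can play so that after $t'$ cop moves she has $k$-caught the robber for some $k\le\alpha-r-t'+1$, for every later $t'\ge t$ for the rest of the game.
   Context: All graphs are finite, nonempty and reflexive (every vertex adjacent to itself). For distinct vertices $v,w$ of a graph $H$: $w$ corners $v$ in $H$ if every vertex of $H$ adjacent to $v$ is adjacent to $w$; $w$ strictly corners $v$ in $H$ if moreover some vertex of $H$ adjacent to $w$ is not adjacent to $v$; a strict corner of $H$ is a vertex strictly cornered in $H$ by another vertex. We also say $c$ corners $x$ in $H$ when $c=x$. Corner ranking: $G_1=G$, $k=1$. If $G_k$ is a clique, its vertices get rank $k$; stop. Else if $G_k$ has no strict corners, its vertices get rank $\infty$; stop. Else the set $X$ of strict corners of $G_k$ gets rank $k$, $G_{k+1}=G_k-X$, increase $k$, repeat. $\mathrm{cr}(v)$ is the rank of $v$, $\mathrm{cr}(G)$ the maximum rank. For finite corner rank $\alpha\ge2$: $G$ is $1$-cop-win if some (equivalently every) vertex of rank $\alpha$ is adjacent to all vertices of $G_{\alpha-1}$, otherwise $0$-cop-win.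 Projections: $f_k(\{u\})=\{u\}$ if $\mathrm{cr}(u)>k$, otherwise the set of vertices of $G_{k+1}$ that strictly corner $u$ in $G_k$; $f_k(S)=\bigcup_{u\in S}f_k(\{u\})$; $F_1$ the identity, $F_k=f_{k-1}\circ\cdots\circ f_1$, $F_k(v)=F_k(\{v\})$. Game: cop places, robber places, then alternate moves with the cop first; a move is staying or moving to an adjacent vertex; the cop wins when both share a vertex. With the cop at $c$ and robber at $x$: $x$ is $0$-cornered if $c=x$; for $k\ge1$, $x$ is $k$-cornered by $c$ if some $x'\in F_k(x)$ is cornered by $c$ in the subgraph induced by $V(G_k)\cup\{c\}$; for $k\ge 1$ the cop has $k$-caught the robber if $c\in F_k(x)$. -}

module Defs where

open import Data.Nat using (ℕ; zero; suc; _+_; _∸_; _≤_; _<_)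
open import Data.Fin using (Fin; _≟_)
open import Data.Bool using (Bool; true; false; _∧_; _∨_; not; if_then_else_)
open import Data.List using (List; allFin; map; upTo)
open import Data.Bool.ListAction using (all; any)
open import Data.Product using (Σ; ∃; _×_; _,_)
open import Data.Sum using (_⊎_)
open import Data.Empty using (⊥)
open import Relation.Nullary using (¬_; does)
open import Relation.Binary.PropositionalEquality using (_≡_; _≢_)

record Graph (n : ℕ) : Set where
  field
    adj       : Fin n → Fin n → Bool
    adj-refl  : ∀ v → adj v v ≡ true
    adj-sym   : ∀ v w → adj v w ≡ adj w v
    nonempty  : 1 ≤ n

Subset : ℕ → Set
Subset n = Fin n → Bool

data Rank : Set where
  fin : ℕ → Rank
  ∞   : Rank

module _ {n : ℕ} (G : Graph n) where
  open Graph G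

  allV : (Fin n → Bool) → Bool
  allV p = all p (allFin n)

  anyV : (Fin n → Bool) → Bool
  anyV p = any p (allFin n)

  eqV : Fin n → Fin n → Bool
  eqV v w = does (v ≟ w)

  cornersIn : Subset n → Fin n → Fin n → Bool
  cornersIn S w v = not (eqV w v) ∧ allV (λ y → not (S y ∧ adj v y) ∨ adj w y)

  strictlyCornersIn : Subset n → Fin n → Fin n → Bool
  strictlyCornersIn S w v =
    cornersIn S w v ∧ anyV (λ y → S y ∧ adj w y ∧ not (adj v y))

  isStrictCorner : Subset n → Fin n → Bool
  isStrictCorner S v = S v ∧ anyV (λ w → S w ∧ strictlyCornersIn S w v)

  hasStrictCorner : Subset n → Bool
  hasStrictCorner S = anyV (isStrictCorner S)

  isClique : Subset n → Bool
  isClique S = allV (λ v → allV (λ w → not (S v ∧ S w) ∨ adj v w))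

  next : Subset n → Subset n
  next S = if isClique S then (λ _ → false)
           else if hasStrictCorner S then (λ v → S v ∧ not (isStrictCorner S v))
           else (λ _ → false)

  -- layer k = G_k for k ≥ 1 (layer 0 is an unused dummy, equal to G_1).
  layer : ℕ → Subset n
  layer zero = λ _ → true
  layer (suc zero) = λ _ → true
  layer (suc (suc k)) = next (layer (suc k))

  data HasRank (v : Fin n) : Rank → Set where
    clique : ∀ k → 1 ≤ k → layer k v ≡ true → isClique (layer k) ≡ true →
             HasRank v (fin k)
    strict : ∀ k → 1 ≤ k → isClique (layer k) ≡ false →
             isStrictCorner (layer k) v ≡ true → HasRank v (fin k)
    stuck  : ∀ k → 1 ≤ k → layer k v ≡ true → isClique (layer k) ≡ false →
             hasStrictCorner (layer k) ≡ false → HasRank v ∞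

  CornerRank : ℕ → Set
  CornerRank α = (∀ v → ∃ λ j → j ≤ α × HasRank v (fin j))
               × (∃ λ v → HasRank v (fin α))

  OneCopWin : ℕ → Set
  OneCopWin α = ∃ λ v → HasRank v (fin α) ×
                  (∀ w → layer (α ∸ 1) w ≡ true → adj v w ≡ true)

  RCopWin : ℕ → ℕ → Set
  RCopWin α zero = ¬ OneCopWin α
  RCopWin α (suc zero) = OneCopWin α
  RCopWin α (suc (suc _)) = ⊥

  RankGt : Fin n → ℕ → Set
  RankGt u k = HasRank u ∞ ⊎ (∃ λ j → k < j × HasRank u (fin j))

  RankLe : Fin n → ℕ → Set
  RankLe u k = ∃ λ j → j ≤ k × HasRank u (fin j)

  -- InF v k x : x ∈ F_k(v)  (k ≥ 1), with F_{k+1}(v) = f_k(F_k(v)).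
  data InF (v : Fin n) : ℕ → Fin n → Set where
    base : InF v 1 v
    keep : ∀ {k u} → InF v k u → RankGt u k → InF v (suc k) u
    proj : ∀ {k u x} → InF v k u → RankLe u k →
           layer (suc k) x ≡ true → strictlyCornersIn (layer k) x u ≡ true →
           InF v (suc k) x

  Corners : Subset n → Fin n → Fin n → Set
  Corners S c x = c ≡ x ⊎ cornersIn S c x ≡ true

  KCornered : ℕ → Fin n → Fin n → Set
  KCornered zero c x = c ≡ x
  KCornered (suc k) c x =
    ∃ λ x' → InF x (suc k) x' × Corners (λ v → layer (suc k) v ∨ eqV v c) c x'

  KCaught : ℕ → Fin n → Fin n → Set
  KCaught k c x = 1 ≤ k × InF x k c

  LW : ℕ → ℕ → ℕ → Fin n → Fin n → Set
  LW α r t c x = ∃ λ k → k + r + t ≤ α × KCornered k c x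

  CondC : ℕ → ℕ → ℕ → Fin n → Fin n → Set
  CondC α r t c x = ∃ λ k → k + r + t ≤ suc α × KCaught k c x

  -- A cop strategy maps the robber's positions so far (x_0, …, x_i) to the
  -- cop's next position.

  Strategy : Set
  Strategy = List (Fin n) → Fin n

  history : (ℕ → Fin n) → ℕ → List (Fin n)
  history ρ i = map ρ (upTo (suc i))

  copPos : Strategy → Fin n → (ℕ → Fin n) → ℕ → Fin n
  copPos σ c ρ zero = c
  copPos σ c ρ (suc i) = σ (history ρ (suc i))

  LegalRobber : (ℕ → Fin n) → Set
  LegalRobber ρ = ∀ i → adj (ρ i) (ρ (suc i)) ≡ true

  LegalCop : Strategy → Fin n → (ℕ → Fin n) → Set
  LegalCop σ c ρ = ∀ i → adj (copPos σ c ρ i) (copPos σ c ρ (suc i)) ≡ true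

  Alive : Strategy → Fin n → (ℕ → Fin n) → ℕ → Set
  Alive σ c ρ i = ∀ j → j < i →
    (copPos σ c ρ j ≢ ρ j) × (ρ (suc j) ≢ copPos σ c ρ j)

  CopCanMaintain : (ℕ → Fin n → Fin n → Set) → ℕ → Fin n → Fin n → Set
  CopCanMaintain P t c x = Σ Strategy λ σ → ∀ (ρ : ℕ → Fin n) → ρ 0 ≡ x →
    LegalRobber ρ →
    LegalCop σ c ρ × (∀ i → Alive σ c ρ i → P (t + i) (copPos σ c ρ i) (ρ i))

module Submission where

-- If the robber steps from x to y, every vertex of the projection F_k(x) is adjacent to some
-- vertex of F_k(y): a vertex w leaving G_{k+1} is strictly cornered in G_k by a vertex of G_{k+1}
-- (follow strict cornerers upwards until one is not itself a strict corner), and such a cornerer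
-- inherits all adjacencies of w inside G_k. Consequently a cop who k-corners (k-catches) the robber
-- can answer any robber move by a move that (k-1)-corners ((k-1)-catches) him, and the bounds
-- α - r - t (resp. α - r - t + 1) drop by one per round as well.

open import Defs
open import Data.Nat using (ℕ; zero; suc; _+_; _∸_; _≤_; _<_; z≤n; s≤s; _≤′_; ≤′-refl; ≤′-step; _≤?_)
open import Data.Nat.Properties
  using (≤⇒≤′; <-cmp; ≰⇒>; ∸-monoʳ-<; +-identityʳ; +-suc; n<1+n; m<n⇒m<1+n; ≤-trans; m≤m+n; anyUpTo?)
open import Data.Nat.Induction using (<-wellFounded)
open import Induction.WellFounded using (Acc; acc)
open import Data.Bool using (true; false; _∧_; _∨_; not)
open import Data.Bool.Properties using (T-≡; ∧-zeroʳ; ¬-not; not-injective) renaming (_≟_ to _≟ᵇ_)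
open import Data.Fin using (Fin; _≟_)
open import Data.Fin.Properties using (any?)
open import Data.Fin.Subset as Sub using (_⊂_; ∣_∣)
open import Data.Fin.Subset.Properties using (p⊂q⇒∣p∣<∣q∣; ∣p∣≤n)
open import Data.Vec using (tabulate)
open import Data.Vec.Properties using (lookup⇒[]=; []=⇒lookup; lookup∘tabulate)
open import Data.List using (List; _∷_; allFin; map; upTo; downFrom; reverse; length)
open import Data.List.Properties using (reverse-map; reverse-upTo; length-map; length-downFrom)
open import Data.List.Membership.Propositional.Properties using (∈-allFin)
open import Data.List.Relation.Unary.All as All using ()
open import Data.List.Relation.Unary.All.Properties using (all⁺; all⁻)
open import Data.List.Relation.Unary.Any using (satisfied)
open import Data.List.Relation.Unary.Any.Properties using (any⁺; any⁻)
open import Data.List.Membership.Propositional using (lose)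
open import Data.Product using (∃; _×_; _,_; proj₁; proj₂)
open import Data.Sum using (_⊎_; inj₁; inj₂)
open import Data.Empty using (⊥-elim)
open import Function.Bundles using (Equivalence)
open import Relation.Nullary using (¬_; Dec; yes; no; _×-dec_; _⊎-dec_)
open import Relation.Nullary.Decidable using (dec-false; map′)
open import Relation.Binary.PropositionalEquality
  using (_≡_; _≢_; refl; sym; trans; cong; cong₂; subst; subst₂; module ≡-Reasoning)
open import Relation.Binary.Definitions using (tri<; tri≈; tri>)

∧≡true⁻ : ∀ {a b} → a ∧ b ≡ true → a ≡ true × b ≡ true
∧≡true⁻ {true} {true} _ = refl , refl

∧≡true⁺ : ∀ {a b} → a ≡ true → b ≡ true → a ∧ b ≡ true
∧≡true⁺ refl refl = refl

∨≡true⁻ : ∀ {a b} → a ∨ b ≡ true → a ≡ true ⊎ b ≡ true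
∨≡true⁻ {true} _ = inj₁ refl
∨≡true⁻ {false} h = inj₂ h

∨≡true⁺ˡ : ∀ {a b} → a ≡ true → a ∨ b ≡ true
∨≡true⁺ˡ refl = refl

not≡true⁻ : ∀ {a} → not a ≡ true → a ≡ false
not≡true⁻ {false} _ = refl

not∨≡true⇒ : ∀ {a b} → not a ∨ b ≡ true → a ≡ true → b ≡ true
not∨≡true⇒ h refl = h

⇒not∨≡true : ∀ {a b} → (a ≡ true → b ≡ true) → not a ∨ b ≡ true
⇒not∨≡true {false} _ = refl
⇒not∨≡true {true} h = h refl

true≢false : ∀ {a} → a ≡ true → a ≢ false
true≢false refl ()

+-≤⇒≤ : ∀ {k r t b} → k + r + t ≤ b → k ≤ b
+-≤⇒≤ {k} {r} {t} bound = ≤-trans (≤-trans (m≤m+n k r) (m≤m+n (k + r) t)) bound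

∃-bounded? : ∀ {P : ℕ → Set} → (∀ k → Dec (P k)) → ∀ b → (∀ {k} → P k → k ≤ b) → Dec (∃ P)
∃-bounded? P? b bounded =
  map′ (λ (k , _ , Pk) → k , Pk) (λ (k , Pk) → k , s≤s (bounded Pk) , Pk) (anyUpTo? P? (suc b))

module _ {n : ℕ} (G : Graph n) where
  open Graph G

  adj-sym′ : ∀ {v w} → adj v w ≡ true → adj w v ≡ true
  adj-sym′ {v} {w} h = trans (adj-sym w v) h

  eqV≡true⁻ : ∀ {v w} → eqV G v w ≡ true → v ≡ w
  eqV≡true⁻ {v} {w} h with v ≟ w
  ... | yes v≡w = v≡w

  allV≡true⁻ : ∀ {p} → allV G p ≡ true → ∀ v → p v ≡ true
  allV≡true⁻ {p} h v =
    Equivalence.to T-≡ (All.lookup (all⁺ p (allFin n) (Equivalence.from T-≡ h)) (∈-allFin v))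

  allV≡true⁺ : ∀ {p} → (∀ v → p v ≡ true) → allV G p ≡ true
  allV≡true⁺ {p} h = Equivalence.to T-≡ (all⁻ p {allFin n} (All.tabulate λ {v} _ → Equivalence.from T-≡ (h v)))

  anyV≡true⁻ : ∀ {p} → anyV G p ≡ true → ∃ λ v → p v ≡ true
  anyV≡true⁻ {p} h with v , pv ← satisfied (any⁻ p (allFin n) (Equivalence.from T-≡ h)) =
    v , Equivalence.to T-≡ pv

  anyV≡true⁺ : ∀ {p} v → p v ≡ true → anyV G p ≡ true
  anyV≡true⁺ {p} v pv = Equivalence.to T-≡ (any⁺ p (lose (∈-allFin v) (Equivalence.from T-≡ pv)))

  corners⇒adj : ∀ {S w v y} → cornersIn G S w v ≡ true → S y ≡ true → adj v y ≡ true → adj w y ≡ true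
  corners⇒adj {S} {w} {v} {y} h Sy vy =
    not∨≡true⇒ (allV≡true⁻ {λ y → not (S y ∧ adj v y) ∨ adj w y} (proj₂ (∧≡true⁻ h)) y)
               (∧≡true⁺ Sy vy)

  corners⁺ : ∀ {S w v} → w ≢ v → (∀ y → S y ≡ true → adj v y ≡ true → adj w y ≡ true) →
             cornersIn G S w v ≡ true
  corners⁺ {w = w} {v} w≢v h =
    ∧≡true⁺ (cong not (dec-false (w ≟ v) w≢v))
            (allV≡true⁺ λ y → ⇒not∨≡true λ Sy∧vy → let Sy , vy = ∧≡true⁻ Sy∧vy in h y Sy vy)

  corners-insert : ∀ {S w v} → cornersIn G S w v ≡ true → cornersIn G (λ z → S z ∨ eqV G z w) w v ≡ true
  corners-insert {S} {w} {v} h =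
    ∧≡true⁺ (proj₁ (∧≡true⁻ h))
            (allV≡true⁺ λ y → ⇒not∨≡true λ S′y∧vy → adjacent y (∧≡true⁻ S′y∧vy))
    where
    adjacent : ∀ y → (S y ∨ eqV G y w) ≡ true × adj v y ≡ true → adj w y ≡ true
    adjacent y (S′y , vy) with ∨≡true⁻ S′y
    ... | inj₁ Sy = corners⇒adj h Sy vy
    ... | inj₂ y≡w = subst (λ z → adj w z ≡ true) (sym (eqV≡true⁻ y≡w)) (adj-refl w)

  strictlyCorners⇒corners : ∀ {S w v} → strictlyCornersIn G S w v ≡ true → cornersIn G S w v ≡ true
  strictlyCorners⇒corners h = proj₁ (∧≡true⁻ h)

  strictlyCorners-witness : ∀ {S w v} → strictlyCornersIn G S w v ≡ true →
                            ∃ λ y → S y ≡ true × adj w y ≡ true × adj v y ≡ false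
  strictlyCorners-witness {S} {w} {v} h
    with y , e ← anyV≡true⁻ {λ y → S y ∧ adj w y ∧ not (adj v y)} (proj₂ (∧≡true⁻ h))
    with Sy , wy∧v≁y ← ∧≡true⁻ e
    with wy , v≁y ← ∧≡true⁻ wy∧v≁y = y , Sy , wy , not≡true⁻ v≁y

  strictlyCorners⁺ : ∀ {S w v y} → cornersIn G S w v ≡ true →
                     S y ≡ true → adj w y ≡ true → adj v y ≡ false → strictlyCornersIn G S w v ≡ true
  strictlyCorners⁺ {S} {w} {v} {y} c Sy wy v≁y =
    ∧≡true⁺ c (anyV≡true⁺ {λ y → S y ∧ adj w y ∧ not (adj v y)} y
                          (∧≡true⁺ Sy (∧≡true⁺ wy (cong not v≁y))))

  strictlyCorners-trans : ∀ {S a b c} → strictlyCornersIn G S a b ≡ true → strictlyCornersIn G S b c ≡ true →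
                          strictlyCornersIn G S a c ≡ true
  strictlyCorners-trans {S} {a} {b} {c} a⊐b b⊐c
    with y , Sy , by , c≁y ← strictlyCorners-witness b⊐c =
    strictlyCorners⁺ (corners⁺ a≢c λ z Sz cz → corners⇒adj a≥b Sz (corners⇒adj b≥c Sz cz)) Sy ay c≁y
    where
    a≥b : cornersIn G S a b ≡ true
    a≥b = strictlyCorners⇒corners a⊐b
    b≥c : cornersIn G S b c ≡ true
    b≥c = strictlyCorners⇒corners b⊐c
    ay : adj a y ≡ true
    ay = corners⇒adj a≥b Sy by
    a≢c : a ≢ c
    a≢c refl = true≢false ay c≁y

  neighbourhood : Subset n → Fin n → Sub.Subset n
  neighbourhood S v = tabulate λ y → S y ∧ adj v y

  ∈-neighbourhood⁺ : ∀ {S v y} → S y ∧ adj v y ≡ true → y Sub.∈ neighbourhood S v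
  ∈-neighbourhood⁺ {S} {v} {y} h = lookup⇒[]= y _ (trans (lookup∘tabulate (λ y → S y ∧ adj v y) y) h)

  ∈-neighbourhood⁻ : ∀ {S v y} → y Sub.∈ neighbourhood S v → S y ∧ adj v y ≡ true
  ∈-neighbourhood⁻ {S} {v} {y} m = trans (sym (lookup∘tabulate (λ y → S y ∧ adj v y) y)) ([]=⇒lookup m)

  strictlyCorners⇒neighbourhood-⊂ : ∀ {S w v} → strictlyCornersIn G S w v ≡ true →
                                    neighbourhood S v ⊂ neighbourhood S w
  strictlyCorners⇒neighbourhood-⊂ {S} {w} {v} w⊐v with y , Sy , wy , v≁y ← strictlyCorners-witness w⊐v =
    (λ m → ∈-neighbourhood⁺ (extend (∧≡true⁻ (∈-neighbourhood⁻ m)))) ,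
    y , ∈-neighbourhood⁺ (∧≡true⁺ Sy wy) ,
    λ m → true≢false (proj₂ (∧≡true⁻ (∈-neighbourhood⁻ m))) v≁y
    where
    extend : ∀ {z} → S z ≡ true × adj v z ≡ true → S z ∧ adj w z ≡ true
    extend (Sz , vz) = ∧≡true⁺ Sz (corners⇒adj (strictlyCorners⇒corners w⊐v) Sz vz)

  isStrictCorner⁻ : ∀ {S v} → isStrictCorner G S v ≡ true →
                    ∃ λ w → S w ≡ true × strictlyCornersIn G S w v ≡ true
  isStrictCorner⁻ {S} {v} h
    with w , e ← anyV≡true⁻ {λ w → S w ∧ strictlyCornersIn G S w v} (proj₂ (∧≡true⁻ h)) = w , ∧≡true⁻ e

  -- Climb along strict cornerers: the neighbourhood grows strictly at each step, so this ends.
  strictCorner⇒strictlyCornered-by-nonCorner :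
    ∀ {S v} → isStrictCorner G S v ≡ true →
    ∃ λ w → S w ≡ true × isStrictCorner G S w ≡ false × strictlyCornersIn G S w v ≡ true
  strictCorner⇒strictlyCornered-by-nonCorner {S} {v} h with w , Sw , w⊐v ← isStrictCorner⁻ h =
    climb w (<-wellFounded _) Sw w⊐v
    where
    climb : ∀ w → Acc _<_ (n ∸ ∣ neighbourhood S w ∣) → S w ≡ true → strictlyCornersIn G S w v ≡ true →
            ∃ λ w → S w ≡ true × isStrictCorner G S w ≡ false × strictlyCornersIn G S w v ≡ true
    climb w (acc rs) Sw w⊐v with isStrictCorner G S w in e
    ... | false = w , Sw , e , w⊐v
    ... | true with w′ , Sw′ , w′⊐w ← isStrictCorner⁻ e =
      climb w′ (rs (∸-monoʳ-< (p⊂q⇒∣p∣<∣q∣ (strictlyCorners⇒neighbourhood-⊂ w′⊐w))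
                              (∣p∣≤n (neighbourhood S w′))))
            Sw′ (strictlyCorners-trans w′⊐w w⊐v)

  next-cases : ∀ S → (isClique G S ≡ false × hasStrictCorner G S ≡ true ×
                       (∀ v → next G S v ≡ S v ∧ not (isStrictCorner G S v)))
                     ⊎ (∀ v → next G S v ≡ false)
  next-cases S with isClique G S | hasStrictCorner G S
  ... | true | _ = inj₂ λ _ → refl
  ... | false | true = inj₁ (refl , refl , λ _ → refl)
  ... | false | false = inj₂ λ _ → refl

  removed⇒strictCorner : ∀ {S v} → (∀ v → next G S v ≡ S v ∧ not (isStrictCorner G S v)) →
                         S v ≡ true → next G S v ≡ false → isStrictCorner G S v ≡ true
  removed⇒strictCorner {S} {v} next≡ v∈ v∉ =
    not-injective (subst (λ a → a ∧ not (isStrictCorner G S v) ≡ false) v∈ (trans (sym (next≡ v)) v∉))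

  next⊆ : ∀ S {v} → next G S v ≡ true → S v ≡ true
  next⊆ S {v} h with next-cases S
  ... | inj₁ (_ , _ , next≡) = proj₁ (∧≡true⁻ (trans (sym (next≡ v)) h))
  ... | inj₂ empty = ⊥-elim (true≢false h (empty v))

  layer-suc⊆ : ∀ k {v} → layer G (suc k) v ≡ true → layer G k v ≡ true
  layer-suc⊆ zero h = h
  layer-suc⊆ (suc k) h = next⊆ (layer G (suc k)) h

  layer-antitone : ∀ {j k v} → j ≤ k → layer G k v ≡ true → layer G j v ≡ true
  layer-antitone j≤k = go (≤⇒≤′ j≤k)
    where
    go : ∀ {j k v} → j ≤′ k → layer G k v ≡ true → layer G j v ≡ true
    go ≤′-refl h = h
    go (≤′-step {k} j≤′k) h = go j≤′k (layer-suc⊆ k h)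

  hasRank⇒∈layer : ∀ {u m} → HasRank G u (fin m) → layer G m u ≡ true
  hasRank⇒∈layer (clique _ _ u∈ _) = u∈
  hasRank⇒∈layer (strict _ _ _ corner) = proj₁ (∧≡true⁻ corner)

  hasRank⇒∉layer-suc : ∀ {u m} → HasRank G u (fin m) → layer G (suc m) u ≡ false
  hasRank⇒∉layer-suc {u} (clique (suc k) _ _ clq) with next-cases (layer G (suc k))
  ... | inj₁ (¬clq , _) = ⊥-elim (true≢false clq ¬clq)
  ... | inj₂ empty = empty u
  hasRank⇒∉layer-suc {u} (strict (suc k) _ _ corner) with next-cases (layer G (suc k))
  ... | inj₁ (_ , _ , next≡) =
    trans (next≡ u) (trans (cong (λ b → layer G (suc k) u ∧ not b) corner) (∧-zeroʳ _))
  ... | inj₂ empty = empty u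

  stuck⇒layer-suc-empty : ∀ k {v} → 1 ≤ k → isClique G (layer G k) ≡ false →
                          hasStrictCorner G (layer G k) ≡ false → layer G (suc k) v ≡ false
  stuck⇒layer-suc-empty (suc k) {v} _ _ noCorner with next-cases (layer G (suc k))
  ... | inj₁ (_ , corner , _) = ⊥-elim (true≢false corner noCorner)
  ... | inj₂ empty = empty v

  finiteRank⇒¬∞ : ∀ {u m} → HasRank G u (fin m) → ¬ HasRank G u ∞
  finiteRank⇒¬∞ {u} {m} r (stuck k k≥1 u∈ ¬clq noCorner) with <-cmp m k
  ... | tri< m<k _ _ = true≢false (layer-antitone m<k u∈) (hasRank⇒∉layer-suc r)
  ... | tri> _ _ k<m = true≢false (layer-antitone k<m (hasRank⇒∈layer r))
                                  (stuck⇒layer-suc-empty k k≥1 ¬clq noCorner)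
  ... | tri≈ _ refl _ with r
  ...   | clique _ _ _ clq = true≢false clq ¬clq
  ...   | strict _ _ _ corner = true≢false (anyV≡true⁺ {isStrictCorner G (layer G k)} u corner) noCorner

  leavingLayer⇒strictlyCornered :
    ∀ k {w z} → layer G k w ≡ true → layer G (suc k) w ≡ false → layer G (suc k) z ≡ true →
    ∃ λ w′ → layer G (suc k) w′ ≡ true × strictlyCornersIn G (layer G k) w′ w ≡ true
  leavingLayer⇒strictlyCornered zero _ () _
  leavingLayer⇒strictlyCornered (suc k) {w} {z} w∈ w∉ z∈ with next-cases (layer G (suc k))
  ... | inj₂ empty = ⊥-elim (true≢false z∈ (empty z))
  ... | inj₁ (_ , _ , next≡)
    with w′ , w′∈ , w′-nonCorner , w′⊐w
           ← strictCorner⇒strictlyCornered-by-nonCorner (removed⇒strictCorner next≡ w∈ w∉) =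
    w′ , trans (next≡ w′) (cong₂ (λ a b → a ∧ not b) w′∈ w′-nonCorner) , w′⊐w

  -- InProj k u x : x ∈ f_k({u}); F_{k+1}(v) is the union of these sets over u ∈ F_k(v).
  InProj : ℕ → Fin n → Fin n → Set
  InProj k u x = (x ≡ u × RankGt G u k)
               ⊎ (RankLe G u k × layer G (suc k) x ≡ true × strictlyCornersIn G (layer G k) x u ≡ true)

  InF-suc : ∀ {v k u x} → InF G v k u → InProj k u x → InF G v (suc k) x
  InF-suc p (inj₁ (refl , u>k)) = keep p u>k
  InF-suc p (inj₂ (u≤k , x∈ , x⊐u)) = proj p u≤k x∈ x⊐u

  InF-pred : ∀ {v k x} → InF G v (suc (suc k)) x → ∃ λ u → InF G v (suc k) u × InProj (suc k) u x
  InF-pred (keep p u>k) = _ , p , inj₁ (refl , u>k)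
  InF-pred (proj p u≤k x∈ x⊐u) = _ , p , inj₂ (u≤k , x∈ , x⊐u)

  InF-zero : ∀ {v u} → ¬ InF G v 0 u
  InF-zero ()

  InF-one : ∀ {v u} → InF G v 1 u → u ≡ v
  InF-one base = refl
  InF-one (keep () _)
  InF-one (proj () _ _ _)

  InProj⇒Corners : ∀ {k u x} → InProj k u x → Corners G (λ z → layer G k z ∨ eqV G z x) x u
  InProj⇒Corners (inj₁ (refl , _)) = inj₁ refl
  InProj⇒Corners (inj₂ (_ , _ , x⊐u)) = inj₂ (corners-insert (strictlyCorners⇒corners x⊐u))

  Corners⇒adj : ∀ {S : Subset n} {c x z} → Corners G (λ v → S v ∨ eqV G v c) c x →
                S z ≡ true → adj x z ≡ true → adj c z ≡ true
  Corners⇒adj (inj₁ refl) _ xz = xz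
  Corners⇒adj (inj₂ c≥x) Sz xz = corners⇒adj c≥x (∨≡true⁺ˡ Sz) xz

  module _ (finite : ∀ v → ∃ λ j → HasRank G v (fin j)) where

    rankGt⇒∈layer : ∀ {u k} → RankGt G u k → layer G (suc k) u ≡ true
    rankGt⇒∈layer {u} (inj₁ u∞) = ⊥-elim (finiteRank⇒¬∞ (proj₂ (finite u)) u∞)
    rankGt⇒∈layer (inj₂ (_ , k<j , r)) = layer-antitone k<j (hasRank⇒∈layer r)

    ∈layer⇒rankGt : ∀ {u k} → layer G (suc k) u ≡ true → RankGt G u k
    ∈layer⇒rankGt {u} {k} u∈ with j , r ← finite u with j ≤? k
    ... | yes j≤k = ⊥-elim (true≢false (layer-antitone (s≤s j≤k) u∈) (hasRank⇒∉layer-suc r))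
    ... | no j≰k = inj₂ (j , ≰⇒> j≰k , r)

    rankLe⇒∉layer : ∀ {u k} → RankLe G u k → layer G (suc k) u ≡ false
    rankLe⇒∉layer (_ , j≤k , r) =
      ¬-not λ u∈ → true≢false (layer-antitone (s≤s j≤k) u∈) (hasRank⇒∉layer-suc r)

    ∉layer⇒rankLe : ∀ {u k} → layer G (suc k) u ≡ false → RankLe G u k
    ∉layer⇒rankLe {u} {k} u∉ with j , r ← finite u with j ≤? k
    ... | yes j≤k = j , j≤k , r
    ... | no j≰k = ⊥-elim (true≢false (layer-antitone (≰⇒> j≰k) (hasRank⇒∈layer r)) u∉)

    InF⇒∈layer : ∀ {v k u} → InF G v k u → layer G k u ≡ true
    InF⇒∈layer base = refl
    InF⇒∈layer (keep _ u>k) = rankGt⇒∈layer u>k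
    InF⇒∈layer (proj _ _ x∈ _) = x∈

    InProj⇒∈layer : ∀ {k u x} → InProj k u x → layer G (suc k) x ≡ true
    InProj⇒∈layer (inj₁ (refl , u>k)) = rankGt⇒∈layer u>k
    InProj⇒∈layer (inj₂ (_ , x∈ , _)) = x∈

    InProj⇒adj : ∀ {k u x z} → InProj k u x → layer G k z ≡ true → adj u z ≡ true → adj x z ≡ true
    InProj⇒adj (inj₁ (refl , _)) _ uz = uz
    InProj⇒adj (inj₂ (_ , _ , x⊐u)) z∈ uz = corners⇒adj (strictlyCorners⇒corners x⊐u) z∈ uz

    InProj-adj : ∀ k {w z} → layer G k w ≡ true → layer G (suc k) z ≡ true → adj z w ≡ true →
                 ∃ λ w′ → InProj k w w′ × adj z w′ ≡ true
    InProj-adj k {w} {z} w∈ z∈ zw with layer G (suc k) w in w∈′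
    ... | true = w , inj₁ (refl , ∈layer⇒rankGt w∈′) , zw
    ... | false with w′ , w′∈ , w′⊐w ← leavingLayer⇒strictlyCornered k w∈ w∈′ z∈ =
      w′ , inj₂ (∉layer⇒rankLe w∈′ , w′∈ , w′⊐w) ,
      adj-sym′ (corners⇒adj (strictlyCorners⇒corners w′⊐w) (layer-suc⊆ k z∈) (adj-sym′ zw))

    InProj-lift : ∀ {k y u₀ u} → (∃ λ w₀ → InF G y k w₀ × adj u₀ w₀ ≡ true) → InProj k u₀ u →
                  ∃ λ w → InF G y (suc k) w × adj u w ≡ true
    InProj-lift {k} (w₀ , q₀ , u₀w₀) u₀→u
      with w , w₀→w , uw ← InProj-adj k (InF⇒∈layer q₀) (InProj⇒∈layer u₀→u)
                                       (InProj⇒adj u₀→u (InF⇒∈layer q₀) u₀w₀) =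
      w , InF-suc q₀ w₀→w , uw

    InF-adj : ∀ {k x y u} → adj x y ≡ true → InF G x k u → ∃ λ w → InF G y k w × adj u w ≡ true
    InF-adj {y = y} xy base = y , base , xy
    InF-adj xy (keep p u>k) = InProj-lift (InF-adj xy p) (inj₁ (refl , u>k))
    InF-adj xy (proj p u≤k x∈ x⊐u) = InProj-lift (InF-adj xy p) (inj₂ (u≤k , x∈ , x⊐u))

    InF-chase : ∀ k {x y c} → adj x y ≡ true → InF G x (suc (suc k)) c →
                ∃ λ c′ → adj c c′ ≡ true × InF G y (suc k) c′
    InF-chase k xy p
      with u , pu , u→c ← InF-pred p
      with w , pw , uw ← InF-adj xy pu =
      w , InProj⇒adj u→c (InF⇒∈layer pw) uw , pw

    KCornered-chase : ∀ k {x y c} → adj x y ≡ true → KCornered G (suc k) c x →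
                      ∃ λ c′ → adj c c′ ≡ true × KCornered G k c′ y
    KCornered-chase zero {y = y} xy (_ , p , c≥x) with refl ← InF-one p = y , Corners⇒adj c≥x refl xy , refl
    KCornered-chase (suc k) xy (x′ , p , c≥x′)
      with w′ , q′ , x′w′ ← InF-adj xy p
      with w , q , w→w′ ← InF-pred q′ =
      w′ , Corners⇒adj c≥x′ (InF⇒∈layer q′) x′w′ , w , q , InProj⇒Corners w→w′

    RankGt? : ∀ u k → Dec (RankGt G u k)
    RankGt? u k = map′ ∈layer⇒rankGt rankGt⇒∈layer (layer G (suc k) u ≟ᵇ true)

    RankLe? : ∀ u k → Dec (RankLe G u k)
    RankLe? u k = map′ ∉layer⇒rankLe rankLe⇒∉layer (layer G (suc k) u ≟ᵇ false)

    InProj? : ∀ k u x → Dec (InProj k u x)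
    InProj? k u x =
      ((x ≟ u) ×-dec RankGt? u k)
      ⊎-dec (RankLe? u k ×-dec (layer G (suc k) x ≟ᵇ true) ×-dec (strictlyCornersIn G (layer G k) x u ≟ᵇ true))

    InF? : ∀ k v u → Dec (InF G v k u)
    InF? zero v u = no InF-zero
    InF? (suc zero) v u = map′ (λ { refl → base }) InF-one (u ≟ v)
    InF? (suc (suc k)) v x = map′ (λ (u , p , u→x) → InF-suc p u→x) InF-pred
                                  (any? λ u → InF? (suc k) v u ×-dec InProj? (suc k) u x)

    KCornered? : ∀ k c x → Dec (KCornered G k c x)
    KCornered? zero c x = c ≟ x
    KCornered? (suc k) c x =
      any? λ x′ → InF? (suc k) x x′ ×-dec ((c ≟ x′) ⊎-dec (cornersIn G _ c x′ ≟ᵇ true))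

    module _ (α r : ℕ) where

      LW? : ∀ t c x → Dec (LW G α r t c x)
      LW? t c x = ∃-bounded? (λ k → (k + r + t ≤? α) ×-dec KCornered? k c x) α (λ (bound , _) → +-≤⇒≤ bound)

      CondC? : ∀ t c x → Dec (CondC G α r t c x)
      CondC? t c x = ∃-bounded? (λ k → (k + r + t ≤? suc α) ×-dec ((1 ≤? k) ×-dec InF? k x c)) (suc α)
                                (λ (bound , _) → +-≤⇒≤ bound)

      LW-advance : ∀ {t c x y} → LW G α r t c x → c ≢ x → adj x y ≡ true →
                   ∃ λ c′ → adj c c′ ≡ true × LW G α r (suc t) c′ y
      LW-advance (zero , _ , c≡x) c≢x _ = ⊥-elim (c≢x c≡x)
      LW-advance {t} (suc k , bound , cornered) _ xy with c′ , cc′ , cornered′ ← KCornered-chase k xy cornered =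
        c′ , cc′ , k , subst (_≤ α) (sym (+-suc (k + r) t)) bound , cornered′

      CondC-advance : ∀ {t c x y} → CondC G α r t c x → c ≢ x → adj x y ≡ true →
                      ∃ λ c′ → adj c c′ ≡ true × CondC G α r (suc t) c′ y
      CondC-advance (suc zero , _ , _ , p) c≢x _ = ⊥-elim (c≢x (InF-one p))
      CondC-advance {t} (suc (suc k) , bound , _ , p) _ xy with c′ , cc′ , p′ ← InF-chase k xy p =
        c′ , cc′ , suc k , subst (_≤ suc α) (sym (+-suc (suc k + r) t)) bound , s≤s z≤n , p′

  -- The cop keeps an invariant P by answering each robber move with a move restoring P,
  -- found by exhaustive search; this is why P has to be decidable.
  module _ (P : ℕ → Fin n → Fin n → Set) (P? : ∀ t c x → Dec (P t c x))
           (advance : ∀ {t c x y} → P t c x → c ≢ x → adj x y ≡ true →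
                      ∃ λ c′ → adj c c′ ≡ true × P (suc t) c′ y)
    where

    goodReply? : ∀ t c y → Dec (∃ λ c′ → adj c c′ ≡ true × P (suc t) c′ y)
    goodReply? t c y = any? λ c′ → (adj c c′ ≟ᵇ true) ×-dec P? (suc t) c′ y

    reply : ℕ → Fin n → Fin n → Fin n
    reply t c y with goodReply? t c y
    ... | yes (c′ , _) = c′
    ... | no _ = c

    reply-adj : ∀ t c y → adj c (reply t c y) ≡ true
    reply-adj t c y with goodReply? t c y
    ... | yes (_ , cc′ , _) = cc′
    ... | no _ = adj-refl c

    reply-maintains : ∀ {t c y} → (∃ λ c′ → adj c c′ ≡ true × P (suc t) c′ y) → P (suc t) (reply t c y) y
    reply-maintains {t} {c} {y} good with goodReply? t c y
    ... | yes (_ , _ , Pc′) = Pc′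
    ... | no none = ⊥-elim (none good)

    module _ (t : ℕ) (c₀ : Fin n) where

      -- The argument lists the robber's positions, latest first.
      replay : List (Fin n) → Fin n
      replay (y ∷ x ∷ earlier) = reply (t + length earlier) (replay (x ∷ earlier)) y
      replay _ = c₀

      strategy : Strategy G
      strategy history = replay (reverse history)

      copPos≡replay : ∀ ρ i → copPos G strategy c₀ ρ i ≡ replay (map ρ (downFrom (suc i)))
      copPos≡replay ρ zero = refl
      copPos≡replay ρ (suc i) = cong replay (begin
        reverse (map ρ (upTo (2 + i)))  ≡⟨ reverse-map ρ (upTo (2 + i)) ⟨
        map ρ (reverse (upTo (2 + i)))  ≡⟨ cong (map ρ) (reverse-upTo (2 + i)) ⟩
        map ρ (downFrom (2 + i))        ∎)
        where open ≡-Reasoning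

      copPos-suc : ∀ ρ i → copPos G strategy c₀ ρ (suc i) ≡ reply (t + i) (copPos G strategy c₀ ρ i) (ρ (suc i))
      copPos-suc ρ i =
        trans (copPos≡replay ρ (suc i))
              (cong₂ (λ s c → reply (t + s) c (ρ (suc i)))
                     (trans (length-map ρ (downFrom i)) (length-downFrom i)) (sym (copPos≡replay ρ i)))

    maintain : ∀ t c x → P t c x → CopCanMaintain G P t c x
    maintain t c₀ x₀ P₀ =
      strategy t c₀ , λ ρ ρ₀≡x₀ robberLegal → legal ρ , invariant ρ ρ₀≡x₀ robberLegal
      where
      legal : ∀ ρ → LegalCop G (strategy t c₀) c₀ ρ
      legal ρ i = subst (λ c → adj (copPos G (strategy t c₀) c₀ ρ i) c ≡ true)
                        (sym (copPos-suc t c₀ ρ i)) (reply-adj _ _ _)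

      invariant : ∀ ρ → ρ 0 ≡ x₀ → LegalRobber G ρ →
                  ∀ i → Alive G (strategy t c₀) c₀ ρ i → P (t + i) (copPos G (strategy t c₀) c₀ ρ i) (ρ i)
      invariant ρ ρ₀≡x₀ _ zero _ = subst₂ (λ s x → P s c₀ x) (sym (+-identityʳ t)) (sym ρ₀≡x₀) P₀
      invariant ρ ρ₀≡x₀ robberLegal (suc i) alive =
        subst₂ (λ s c → P s c (ρ (suc i))) (sym (+-suc t i)) (sym (copPos-suc t c₀ ρ i))
               (reply-maintains (advance (invariant ρ ρ₀≡x₀ robberLegal i λ j j<i → alive j (m<n⇒m<1+n j<i))
                                         (proj₁ (alive i (n<1+n i))) (robberLegal i)))

theorem4p10 : ∀ {n} (G : Graph n) (α r : ℕ) → 2 ≤ α →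
    CornerRank G α → RCopWin G α r →
    (∀ (t : ℕ) (c x : Fin n) → 1 ≤ t → LW G α r t c x →
      CopCanMaintain G (LW G α r) t c x)
    × (∀ (t : ℕ) (c x : Fin n) → 1 ≤ t → CondC G α r t c x →
      CopCanMaintain G (CondC G α r) t c x)
theorem4p10 G α r _ (ranks , _) _ =
  (λ t c x _ → maintain G (LW G α r) (LW? G finite α r) (LW-advance G finite α r) t c x) ,
  (λ t c x _ → maintain G (CondC G α r) (CondC? G finite α r) (CondC-advance G finite α r) t c x)
  where
  finite : ∀ v → ∃ λ j → HasRank G v (fin j)
  finite v with j , _ , r ← ranks v = j , r
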